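{- Let $\lambda$ be an integer partition and $\gamma=(\gamma_1,\dots,\gamma_k)\in\mathbb{Z}_{\ge0}^k$ with $k\ge1$ and $\gamma_k+1\ge\lambda_1$. Then $$\frac{j_{(\lambda|\gamma_1,\ldots,\gamma_k)}(q,t)}{j_{(\gamma_k+1,\lambda|\gamma_1,\ldots,\gamma_{k-1})}(q,t)}=\big(1-t^{m_{\gamma_k+1}(\lambda)+1}\big)^{ -1}.$$
   Context: $m_i(\lambda)$ is the number of parts of $\lambda$ equal to $i$; $(\gamma_k+1,\lambda)$ is the partition obtained by prepending the part $\gamma_k+1$. For a partition $\lambda$ and $\gamma\in\mathbb{Z}_{\ge0}^k$: let $\lambda_-$ be the weakly increasing rearrangement of $\lambda$ and $\nu=(\lambda_-,\gamma)$ (concatenation), with boxes $(i,j)$, $1\le j\le\nu_i$; the boxes in the first $\ell(\lambda_-)$ positions form the $\lambda_-$ part and the rest the $\gamma$ part. Define $\ell_\nu(i,j)=\nu_i-j$, $a_\nu(i,j)=\#\{r<i:j\le\nu_r\le\nu_i\}+\#\{r>i:j-1\le\nu_r<\nu_i\}$, $\tilde a_\nu(i,j)=\#\{r<i:j\le\nu_r\le\nu_i\}+\#\{r>i:j\le\nu_r<\nu_i\}$, and $j_{(\lambda|\gamma)}(q,t)=\prod_{\square\in\lambda_- }(1-q^{\ell_\nu(\square)}t^{\tilde a_\nu(\square)+1})\prod_{\square\in\gamma}(1-q^{\ell_\nu(\square)+1}t^{a_\nu(\square)+1})\in\mathbb{Q}(q,t)$. -}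

module Defs where

open import Data.Nat using (ℕ; zero; suc; _+_; _∸_; _≤_; _<_; _≥_; _≤ᵇ_; _<ᵇ_; _≡ᵇ_)
open import Data.Nat.Properties using (≤-decTotalOrder)
open import Data.Integer as ℤ using (ℤ; +_; -[1+_])
open import Data.Bool using (Bool; true; false; _∧_; if_then_else_)
open import Data.List using (List; []; _∷_; _++_; length; map; concatMap; upTo; sum)
open import Data.List.Relation.Unary.All using (All)
open import Data.List.Relation.Unary.Linked using (Linked)
open import Data.Product using (_×_; _,_)
open import Relation.Binary.PropositionalEquality using (_≡_)
import Data.List.Sort

-- Polynomials in ℤ[q,t], represented as finite lists of terms
-- (c , a , b) standing for c · q^a · t^b.  Two polynomials are equal
-- iff all their coefficients agree.

Poly : Set
Poly = List (ℤ × ℕ × ℕ)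

coeff : Poly → ℕ → ℕ → ℤ
coeff []                  a b = + 0
coeff ((c , a' , b') ∷ p) a b =
  (if (a' ≡ᵇ a) ∧ (b' ≡ᵇ b) then c else + 0) ℤ.+ coeff p a b

infix 4 _≈P_
_≈P_ : Poly → Poly → Set
p ≈P r = ∀ a b → coeff p a b ≡ coeff r a b

oneP : Poly
oneP = (+ 1 , 0 , 0) ∷ []

infixl 7 _*P_
_*P_ : Poly → Poly → Poly
p *P r = concatMap (λ { (c , a , b) → map (λ { (c' , a' , b') → (c ℤ.* c' , a + a' , b + b') }) r }) p

factor : ℕ → ℕ → Poly
factor a b = (+ 1 , 0 , 0) ∷ (-[1+ 0 ] , a , b) ∷ []

prodP : List Poly → Poly
prodP []       = oneP
prodP (p ∷ ps) = p *P prodP ps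

IsPartition : List ℕ → Set
IsPartition μ = Linked _≥_ μ × All (λ x → 0 < x) μ

firstPart : List ℕ → ℕ
firstPart []      = 0
firstPart (x ∷ _) = x

mult : ℕ → List ℕ → ℕ
mult i []       = 0
mult i (x ∷ xs) = (if x ≡ᵇ i then 1 else 0) + mult i xs

open Data.List.Sort ≤-decTotalOrder using (sort)

increasing : List ℕ → List ℕ
increasing = sort

-- The arm/leg statistics on ν = (λ₋ , γ), rows indexed from 0

nth : List ℕ → ℕ → ℕ
nth []       _       = 0
nth (x ∷ _)  zero    = x
nth (_ ∷ xs) (suc n) = nth xs n

countB : (ℕ → Bool) → List ℕ → ℕ
countB P []       = 0
countB P (r ∷ rs) = (if P r then 1 else 0) + countB P rs

below : ℕ → List ℕ
below i = upTo i

above : ℕ → ℕ → List ℕ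
above n i = map (λ d → suc i + d) (upTo (n ∸ suc i))

legν : List ℕ → ℕ → ℕ → ℕ
legν ν i j = nth ν i ∸ j

armν : List ℕ → ℕ → ℕ → ℕ
armν ν i j =
  countB (λ r → (j ≤ᵇ nth ν r) ∧ (nth ν r ≤ᵇ nth ν i)) (below i)
  + countB (λ r → ((j ∸ 1) ≤ᵇ nth ν r) ∧ (nth ν r <ᵇ nth ν i)) (above (length ν) i)

armν~ : List ℕ → ℕ → ℕ → ℕ
armν~ ν i j =
  countB (λ r → (j ≤ᵇ nth ν r) ∧ (nth ν r ≤ᵇ nth ν i)) (below i)
  + countB (λ r → (j ≤ᵇ nth ν r) ∧ (nth ν r <ᵇ nth ν i)) (above (length ν) i)

cols : ℕ → List ℕ
cols m = map suc (upTo m)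

lamRow : List ℕ → ℕ → List Poly
lamRow ν i = map (λ j → factor (legν ν i j) (armν~ ν i j + 1)) (cols (nth ν i))

gamRow : List ℕ → ℕ → List Poly
gamRow ν i = map (λ j → factor (legν ν i j + 1) (armν ν i j + 1)) (cols (nth ν i))

jPoly : List ℕ → List ℕ → Poly
jPoly μ γ =
  prodP (concatMap (lamRow ν) (upTo L) ++
         concatMap (gamRow ν) (map (λ d → L + d) (upTo (length γ))))
  where
    μ₋ = increasing μ
    L  = length μ₋
    ν  = μ₋ ++ γ

-- Write μ = (G^m, β) with G = g + 1 and all parts of β at most g, and let α be β in increasing
-- order; the two sides are then built from ν = (α, G^m | γ′, g) and ν′ = (α, G^(m+1) | γ′).
-- Each j is a product with one factor per box, and the factors of ν together with 1 − t^(m+1)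
-- are a permutation of those of ν′.  The rows of α and of γ′ give the same factors in both (a row
-- of γ′ sees the final row g of ν exactly when it sees the extra row G of ν′).  The first g boxes
-- of the s-th row G of ν agree with those of the (s+1)-st row G of ν′, and the last box of the
-- s-th row G is 1 − t^(s+1) in both; the first g boxes of the 0-th row G of ν′ come from the
-- final row g of ν, and the last box of its m-th row G is the extra factor.  Polynomials are
-- lists of terms, and permuting terms or factors does not change any coefficient.

{-# OPTIONS --safe #-}
module Submission where

open import Defs
import Algebra.Properties.CommutativeSemigroup as CommSemigroupProperties
import Algebra.Solver.CommutativeMonoid as CommMonoidSolver
open import Data.Bool using (Bool; true; false; _∧_; if_then_else_)
open import Data.Bool.Properties using (∧-zeroʳ)
open import Data.Integer as ℤ using (ℤ)
import Data.Integer.Properties as ℤₚ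
open import Data.List
  using (List; []; _∷_; _++_; [_]; _∷ʳ_; map; concatMap; length; replicate; applyUpTo; upTo)
open import Data.List.Properties
  using (map-cong; map-cong-local; map-∘; map-++; map-applyUpTo; concatMap-cong; concatMap-++;
         ++-assoc; ++-identityʳ; length-++; length-replicate; upTo-∷ʳ)
open import Data.List.Relation.Binary.Permutation.Propositional as ↭
  using (_↭_; prep; swap; ↭-refl; ↭-sym; ↭-trans; ↭-reflexive; ↭⇒↭ₛ; module PermutationReasoning)
import Data.List.Relation.Binary.Permutation.Propositional.Properties as ↭ₚ
open import Data.List.Relation.Binary.Pointwise using (Pointwise-≡⇒≡)
open import Data.List.Relation.Unary.All as All using (All; []; _∷_)
import Data.List.Relation.Unary.All.Properties as Allₚ
open import Data.List.Relation.Unary.AllPairs using (AllPairs; []; _∷_)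
import Data.List.Relation.Unary.AllPairs.Properties as AllPairsₚ
open import Data.List.Relation.Unary.Linked as Linked using (Linked; [-]; _∷_)
open import Data.List.Relation.Unary.Linked.Properties using (Linked⇒All)
open import Data.List.Relation.Unary.Sorted.TotalOrder.Properties using (AllPairs⇒Sorted; Sorted⇒AllPairs; ↗↭↗⇒≋)
open import Data.Nat
  using (ℕ; zero; suc; _+_; _∸_; _≤_; _<_; _≥_; _≤ᵇ_; _<ᵇ_; _≡ᵇ_; _≤?_; _<?_; _≟_; z≤n; s≤s)
open import Data.Nat.Properties as ℕₚ
  using (≤-refl; ≤-trans; ≤-decTotalOrder; ≤-totalOrder; +-assoc; +-comm; +-identityʳ; +-suc)
open import Data.List.Sort ≤-decTotalOrder using (sort; sort-↭; sort-↗)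
open import Data.Nat.Tactic.RingSolver using (solve-∀)
open import Data.Product using (_×_; _,_; ∃₂)
open import Function using (id; _∘_)
open import Relation.Binary.PropositionalEquality as ≡ using (_≡_; cong; cong₂; sym)
open import Relation.Nullary using (¬_; yes; no)
open import Relation.Nullary.Decidable using (dec-true; dec-false)

-- Polynomials up to permutation of their terms

Term : Set
Term = ℤ × ℕ × ℕ

infixl 7 _·_
_·_ : Term → Term → Term
(c , a , b) · (c′ , a′ , b′) = (c ℤ.* c′ , a + a′ , b + b′)

·-comm : ∀ t u → t · u ≡ u · t
·-comm (c , a , b) (c′ , a′ , b′) =
  cong₂ _,_ (ℤₚ.*-comm c c′) (cong₂ _,_ (+-comm a a′) (+-comm b b′))

·-assoc : ∀ t u v → (t · u) · v ≡ t · (u · v)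
·-assoc (c , a , b) (c′ , a′ , b′) (c″ , a″ , b″) =
  cong₂ _,_ (ℤₚ.*-assoc c c′ c″) (cong₂ _,_ (+-assoc a a′ a″) (+-assoc b b′ b″))

coeffₜ : Term → ℕ → ℕ → ℤ
coeffₜ (c , a′ , b′) a b = if (a′ ≡ᵇ a) ∧ (b′ ≡ᵇ b) then c else ℤ.+ 0

coeff-↭ : ∀ {p r} → p ↭ r → p ≈P r
coeff-↭ ↭.refl             a b = ≡.refl
coeff-↭ (prep t p↭r)       a b = cong (ℤ._+_ (coeffₜ t a b)) (coeff-↭ p↭r a b)
coeff-↭ (swap t u p↭r)     a b =
  ≡.trans (x∙yz≈y∙xz (coeffₜ t a b) (coeffₜ u a b) _)
          (cong (λ c → coeffₜ u a b ℤ.+ (coeffₜ t a b ℤ.+ c)) (coeff-↭ p↭r a b))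
  where open CommSemigroupProperties ℤₚ.+-commutativeSemigroup using (x∙yz≈y∙xz)
coeff-↭ (↭.trans p↭q q↭r) a b = ≡.trans (coeff-↭ p↭q a b) (coeff-↭ q↭r a b)

concatMap⁺ : ∀ {A B : Set} (f : A → List B) {xs ys} → xs ↭ ys → concatMap f xs ↭ concatMap f ys
concatMap⁺ f ↭.refl          = ↭-refl
concatMap⁺ f (prep x p)      = ↭ₚ.++⁺ˡ (f x) (concatMap⁺ f p)
concatMap⁺ f (swap x y p)    =
  ↭-trans (↭ₚ.shifts (f x) (f y)) (↭ₚ.++⁺ˡ (f y) (↭ₚ.++⁺ˡ (f x) (concatMap⁺ f p)))
concatMap⁺ f (↭.trans p q)   = ↭-trans (concatMap⁺ f p) (concatMap⁺ f q)

concatMap-const-[] : ∀ {A B : Set} (xs : List A) → concatMap {B = B} (λ _ → []) xs ≡ []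
concatMap-const-[] []       = ≡.refl
concatMap-const-[] (_ ∷ xs) = concatMap-const-[] xs

interleave-↭ : ∀ {A B : Set} (f : A → B) (h : A → List B) xs →
  map f xs ++ concatMap h xs ↭ concatMap (λ x → f x ∷ h x) xs
interleave-↭ f h []       = ↭-refl
interleave-↭ f h (x ∷ xs) =
  prep (f x) (↭-trans (↭ₚ.shifts (map f xs) (h x)) (↭ₚ.++⁺ˡ (h x) (interleave-↭ f h xs)))

concatMap-map-flip : ∀ {A B C : Set} (f : A → B → C) xs ys →
  concatMap (λ x → map (f x) ys) xs ↭ concatMap (λ y → map (λ x → f x y) xs) ys
concatMap-map-flip f []       ys = ↭-reflexive (sym (concatMap-const-[] ys))
concatMap-map-flip f (x ∷ xs) ys =
  ↭-trans (↭ₚ.++⁺ˡ (map (f x) ys) (concatMap-map-flip f xs ys))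
          (interleave-↭ (f x) (λ y → map (λ x → f x y) xs) ys)

*P-congˡ : ∀ p {r r′} → r ↭ r′ → p *P r ↭ p *P r′
*P-congˡ []      r↭r′ = ↭-refl
*P-congˡ (t ∷ p) r↭r′ = ↭ₚ.++⁺ (↭ₚ.map⁺ (t ·_) r↭r′) (*P-congˡ p r↭r′)

*P-congʳ : ∀ {p p′} r → p ↭ p′ → p *P r ↭ p′ *P r
*P-congʳ r = concatMap⁺ (λ t → map (t ·_) r)

*P-comm : ∀ p r → p *P r ↭ r *P p
*P-comm p r = ↭-trans (concatMap-map-flip _·_ p r)
  (↭-reflexive (concatMap-cong (λ u → map-cong (λ t → ·-comm t u) p) r))

map-·-*P : ∀ t r s → map (t ·_) r *P s ≡ map (t ·_) (r *P s)
map-·-*P t []      s = ≡.refl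
map-·-*P t (u ∷ r) s = begin
  map ((t · u) ·_) s ++ map (t ·_) r *P s
    ≡⟨ cong₂ _++_ (≡.trans (map-cong (·-assoc t u) s) (map-∘ s)) (map-·-*P t r s) ⟩
  map (t ·_) (map (u ·_) s) ++ map (t ·_) (r *P s)
    ≡⟨ map-++ (t ·_) (map (u ·_) s) (r *P s) ⟨
  map (t ·_) ((u ∷ r) *P s) ∎
  where open ≡.≡-Reasoning

*P-assoc : ∀ p r s → (p *P r) *P s ≡ p *P (r *P s)
*P-assoc []      r s = ≡.refl
*P-assoc (t ∷ p) r s = begin
  (map (t ·_) r ++ p *P r) *P s
    ≡⟨ concatMap-++ (λ u → map (u ·_) s) (map (t ·_) r) (p *P r) ⟩
  map (t ·_) r *P s ++ (p *P r) *P s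
    ≡⟨ cong₂ _++_ (map-·-*P t r s) (*P-assoc p r s) ⟩
  map (t ·_) (r *P s) ++ p *P (r *P s) ∎
  where open ≡.≡-Reasoning

prodP-↭ : ∀ {ps qs} → ps ↭ qs → prodP ps ↭ prodP qs
prodP-↭ ↭.refl                       = ↭-refl
prodP-↭ (prep p ps↭qs)               = *P-congˡ p (prodP-↭ ps↭qs)
prodP-↭ (swap {xs} {ys} p q ps↭qs) = begin
  p *P (q *P prodP xs)   ≡⟨ *P-assoc p q (prodP xs) ⟨
  (p *P q) *P prodP xs   ↭⟨ *P-congʳ (prodP xs) (*P-comm p q) ⟩
  (q *P p) *P prodP xs   ≡⟨ *P-assoc q p (prodP xs) ⟩
  q *P (p *P prodP xs)   ↭⟨ *P-congˡ q (*P-congˡ p (prodP-↭ ps↭qs)) ⟩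
  q *P (p *P prodP ys)   ∎
  where open PermutationReasoning
prodP-↭ (↭.trans ps↭qs qs↭rs)        = ↭-trans (prodP-↭ ps↭qs) (prodP-↭ qs↭rs)

≤ᵇ-true : ∀ {m n} → m ≤ n → (m ≤ᵇ n) ≡ true
≤ᵇ-true {m} {n} = dec-true (m ≤? n)

≤ᵇ-false : ∀ {m n} → ¬ m ≤ n → (m ≤ᵇ n) ≡ false
≤ᵇ-false {m} {n} = dec-false (m ≤? n)

<ᵇ-false : ∀ {m n} → n ≤ m → (m <ᵇ n) ≡ false
<ᵇ-false {m} {n} n≤m = dec-false (m <? n) (ℕₚ.≤⇒≯ n≤m)

≤ᵇ≡<ᵇ-suc : ∀ m n → (m ≤ᵇ n) ≡ (m <ᵇ suc n)
≤ᵇ≡<ᵇ-suc zero    n = ≡.refl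
≤ᵇ≡<ᵇ-suc (suc m) n = ≡.refl

pred-≤ᵇ : ∀ m n → ((m ∸ 1) ≤ᵇ n) ≡ (m ≤ᵇ suc n)
pred-≤ᵇ zero    n = ≡.refl
pred-≤ᵇ (suc m) n = ≤ᵇ≡<ᵇ-suc m n

indicator : Bool → ℕ
indicator b = if b then 1 else 0

countB-++ : ∀ Q xs ys → countB Q (xs ++ ys) ≡ countB Q xs + countB Q ys
countB-++ Q []       ys = ≡.refl
countB-++ Q (x ∷ xs) ys =
  ≡.trans (cong (indicator (Q x) +_) (countB-++ Q xs ys)) (sym (+-assoc (indicator (Q x)) _ _))

countB-↭ : ∀ Q {xs ys} → xs ↭ ys → countB Q xs ≡ countB Q ys
countB-↭ Q ↭.refl          = ≡.refl
countB-↭ Q (prep x p)      = cong (indicator (Q x) +_) (countB-↭ Q p)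
countB-↭ Q (swap x y p)    =
  ≡.trans (x∙yz≈y∙xz (indicator (Q x)) (indicator (Q y)) _)
          (cong (λ c → indicator (Q y) + (indicator (Q x) + c)) (countB-↭ Q p))
  where open CommSemigroupProperties ℕₚ.+-commutativeSemigroup using (x∙yz≈y∙xz)
countB-↭ Q (↭.trans p q)   = ≡.trans (countB-↭ Q p) (countB-↭ Q q)

countB-map : ∀ Q (f : ℕ → ℕ) xs → countB (λ r → Q (f r)) xs ≡ countB Q (map f xs)
countB-map Q f []       = ≡.refl
countB-map Q f (x ∷ xs) = cong (indicator (Q (f x)) +_) (countB-map Q f xs)

countB-cong : ∀ {Q Q′ xs} → All (λ v → Q v ≡ Q′ v) xs → countB Q xs ≡ countB Q′ xs
countB-cong []         = ≡.refl
countB-cong (q ∷ qs)   = cong₂ (λ b n → indicator b + n) q (countB-cong qs)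

countB-true : ∀ {Q xs} → All (λ v → Q v ≡ true) xs → countB Q xs ≡ length xs
countB-true []         = ≡.refl
countB-true (q ∷ qs)   = cong₂ (λ b n → indicator b + n) q (countB-true qs)

countB-false : ∀ {Q xs} → All (λ v → Q v ≡ false) xs → countB Q xs ≡ 0
countB-false []        = ≡.refl
countB-false (q ∷ qs)  = cong₂ (λ b n → indicator b + n) q (countB-false qs)

countB-replicate : ∀ {Q v} s → Q v ≡ true → countB Q (replicate s v) ≡ s
countB-replicate s q = ≡.trans (countB-true (Allₚ.replicate⁺ s q)) (length-replicate s)

inRange : ℕ → ℕ → ℕ → Bool
inRange j x v = (j ≤ᵇ v) ∧ (v ≤ᵇ x)

inRange< : ℕ → ℕ → ℕ → Bool
inRange< j x v = (j ≤ᵇ v) ∧ (v <ᵇ x)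

inRange-true : ∀ {j x v} → j ≤ v → v ≤ x → inRange j x v ≡ true
inRange-true j≤v v≤x = cong₂ _∧_ (≤ᵇ-true j≤v) (≤ᵇ-true v≤x)

inRange-below : ∀ {j x v} → v < j → inRange j x v ≡ false
inRange-below {j} {x} {v} v<j = cong (_∧ (v ≤ᵇ x)) (≤ᵇ-false (ℕₚ.<⇒≱ v<j))

inRange-above : ∀ {j x v} → x < v → inRange j x v ≡ false
inRange-above {j} {x} {v} x<v = ≡.trans (cong ((j ≤ᵇ v) ∧_) (≤ᵇ-false (ℕₚ.<⇒≱ x<v))) (∧-zeroʳ (j ≤ᵇ v))

inRange<-above : ∀ {j x v} → x ≤ v → inRange< j x v ≡ false
inRange<-above {j} {x} {v} x≤v = ≡.trans (cong ((j ≤ᵇ v) ∧_) (<ᵇ-false x≤v)) (∧-zeroʳ (j ≤ᵇ v))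

inRange<-empty : ∀ x v → inRange< x x v ≡ false
inRange<-empty x v with x ≤? v
... | yes x≤v = inRange<-above {x} x≤v
... | no  x≰v = cong (_∧ (v <ᵇ x)) (≤ᵇ-false x≰v)

Count : Set
Count = (ℕ → Bool) → ℕ

countIn : List ℕ → Count
countIn xs Q = countB Q xs

-- The factors of a row x of the λ- resp. γ-part of ν, given the counting functions of the rows
-- before and after it.
lamBoxes : ℕ → Count → Count → List Poly
lamBoxes x before after =
  map (λ j → factor (x ∸ j) (before (inRange j x) + after (inRange< j x) + 1)) (cols x)

gamBoxes : ℕ → Count → Count → List Poly
gamBoxes x before after =
  map (λ j → factor (x ∸ j + 1) (before (inRange j x) + after (inRange< (j ∸ 1) x) + 1)) (cols x)

lamBoxes-cong : ∀ {x y b b′ a a′} → x ≡ y → (∀ Q → b Q ≡ b′ Q) → (∀ Q → a Q ≡ a′ Q) →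
  lamBoxes x b a ≡ lamBoxes y b′ a′
lamBoxes-cong {x} ≡.refl hb ha =
  map-cong (λ j → cong (λ n → factor (x ∸ j) (n + 1)) (cong₂ _+_ (hb _) (ha _))) (cols x)

gamBoxes-cong : ∀ {x y b b′ a a′} → x ≡ y → (∀ Q → b Q ≡ b′ Q) → (∀ Q → a Q ≡ a′ Q) →
  gamBoxes x b a ≡ gamBoxes y b′ a′
gamBoxes-cong {x} ≡.refl hb ha =
  map-cong (λ j → cong (λ n → factor (x ∸ j + 1) (n + 1)) (cong₂ _+_ (hb _) (ha _))) (cols x)

cols-≤ : ∀ n → All (_≤ n) (cols n)
cols-≤ n = Allₚ.map⁺ (Allₚ.applyUpTo⁺₁ id n id)

cols-suc : ∀ n → cols (suc n) ≡ cols n ++ [ suc n ]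
cols-suc n = ≡.trans (cong (map suc) (sym (upTo-∷ʳ n))) (map-++ suc (upTo n) [ n ])

-- Rows of ν only depend on their length and on the rows before and after them

countAt : List ℕ → List ℕ → Count
countAt ν is Q = countB (λ r → Q (nth ν r)) is

nth-++ : ∀ P T d → nth (P ++ T) (length P + d) ≡ nth T d
nth-++ []      T d = ≡.refl
nth-++ (_ ∷ P) T d = nth-++ P T d

nth-length : ∀ P x S → nth (P ++ x ∷ S) (length P) ≡ x
nth-length []      x S = ≡.refl
nth-length (_ ∷ P) x S = nth-length P x S

applyUpTo-nth : ∀ X S → applyUpTo (nth (X ++ S)) (length X) ≡ X
applyUpTo-nth []      S = ≡.refl
applyUpTo-nth (x ∷ X) S = cong (x ∷_) (applyUpTo-nth X S)

applyUpTo-cong : ∀ {A : Set} {f h : ℕ → A} → (∀ d → f d ≡ h d) → ∀ n → applyUpTo f n ≡ applyUpTo h n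
applyUpTo-cong f≗h zero    = ≡.refl
applyUpTo-cong f≗h (suc n) = cong₂ _∷_ (f≗h 0) (applyUpTo-cong (f≗h ∘ suc) n)

length-above : ∀ P (x : ℕ) S → length (P ++ x ∷ S) ∸ suc (length P) ≡ length S
length-above []      x S = ≡.refl
length-above (_ ∷ P) x S = length-above P x S

countAt-below : ∀ P x S Q → countAt (P ++ x ∷ S) (below (length P)) Q ≡ countB Q P
countAt-below P x S Q = begin
  countB (λ r → Q (nth ν r)) (upTo (length P))  ≡⟨ countB-map Q (nth ν) (upTo (length P)) ⟩
  countB Q (map (nth ν) (upTo (length P)))      ≡⟨ cong (countB Q) (map-applyUpTo id (nth ν) (length P)) ⟩
  countB Q (applyUpTo (nth ν) (length P))       ≡⟨ cong (countB Q) (applyUpTo-nth P (x ∷ S)) ⟩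
  countB Q P                                    ∎
  where
  open ≡.≡-Reasoning
  ν : List ℕ
  ν = P ++ x ∷ S

countAt-above : ∀ P x S Q → countAt (P ++ x ∷ S) (above (length (P ++ x ∷ S)) (length P)) Q ≡ countB Q S
countAt-above P x S Q = begin
  countB (λ r → Q (nth ν r)) (map (suc (length P) +_) (upTo k))
    ≡⟨ countB-map Q (nth ν) (map (suc (length P) +_) (upTo k)) ⟩
  countB Q (map (nth ν) (map (suc (length P) +_) (upTo k)))
    ≡⟨ cong (countB Q) (≡.trans (cong (map (nth ν)) (map-applyUpTo id _ k)) (map-applyUpTo _ (nth ν) k)) ⟩
  countB Q (applyUpTo (λ d → nth ν (suc (length P) + d)) k)
    ≡⟨ cong (countB Q) (applyUpTo-cong shift k) ⟩
  countB Q (applyUpTo (nth (S ++ [])) k)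
    ≡⟨ cong (λ n → countB Q (applyUpTo (nth (S ++ [])) n)) (length-above P x S) ⟩
  countB Q (applyUpTo (nth (S ++ [])) (length S))
    ≡⟨ cong (countB Q) (applyUpTo-nth S []) ⟩
  countB Q S ∎
  where
  open ≡.≡-Reasoning
  ν : List ℕ
  ν = P ++ x ∷ S
  k : ℕ
  k = length ν ∸ suc (length P)
  shift : ∀ d → nth ν (suc (length P) + d) ≡ nth (S ++ []) d
  shift d = ≡.trans (cong (nth ν) (sym (+-suc (length P) d)))
                    (≡.trans (nth-++ P (x ∷ S) (suc d)) (cong (λ T → nth T d) (sym (++-identityʳ S))))

lamRow-local : ∀ P x S → lamRow (P ++ x ∷ S) (length P) ≡ lamBoxes x (countIn P) (countIn S)
lamRow-local P x S = lamBoxes-cong (nth-length P x S) (countAt-below P x S) (countAt-above P x S)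

gamRow-local : ∀ P x S → gamRow (P ++ x ∷ S) (length P) ≡ gamBoxes x (countIn P) (countIn S)
gamRow-local P x S = gamBoxes-cong (nth-length P x S) (countAt-below P x S) (countAt-above P x S)

Boxes : Set
Boxes = ℕ → Count → Count → List Poly

-- Rows boxes P X S: the factors of the rows X of P ++ X ++ S.
Rows : Boxes → List ℕ → List ℕ → List ℕ → List Poly
Rows boxes P []      S = []
Rows boxes P (x ∷ X) S = boxes x (countIn P) (countIn (X ++ S)) ++ Rows boxes (P ++ [ x ]) X S

Rows-++ : ∀ boxes P X Y S → Rows boxes P (X ++ Y) S ≡ Rows boxes P X (Y ++ S) ++ Rows boxes (P ++ X) Y S
Rows-++ boxes P []      Y S = cong (λ P′ → Rows boxes P′ Y S) (sym (++-identityʳ P))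
Rows-++ boxes P (x ∷ X) Y S = begin
  boxes x (countIn P) (countIn ((X ++ Y) ++ S)) ++ Rows boxes (P ++ [ x ]) (X ++ Y) S
    ≡⟨ cong₂ _++_ (cong (λ T → boxes x (countIn P) (countIn T)) (++-assoc X Y S)) (Rows-++ boxes (P ++ [ x ]) X Y S) ⟩
  row ++ (Rows boxes (P ++ [ x ]) X (Y ++ S) ++ Rows boxes ((P ++ [ x ]) ++ X) Y S)
    ≡⟨ cong (λ P′ → row ++ (Rows boxes (P ++ [ x ]) X (Y ++ S) ++ Rows boxes P′ Y S)) (++-assoc P [ x ] X) ⟩
  row ++ (Rows boxes (P ++ [ x ]) X (Y ++ S) ++ Rows boxes (P ++ x ∷ X) Y S)
    ≡⟨ ++-assoc row _ _ ⟨
  (row ++ Rows boxes (P ++ [ x ]) X (Y ++ S)) ++ Rows boxes (P ++ x ∷ X) Y S ∎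
  where
  open ≡.≡-Reasoning
  row : List Poly
  row = boxes x (countIn P) (countIn (X ++ Y ++ S))

rows-local : ∀ (row : List ℕ → ℕ → List Poly) boxes →
  (∀ P x S → row (P ++ x ∷ S) (length P) ≡ boxes x (countIn P) (countIn S)) →
  ∀ P X S → concatMap (row (P ++ X ++ S)) (applyUpTo (length P +_) (length X)) ≡ Rows boxes P X S
rows-local row boxes local P []      S = ≡.refl
rows-local row boxes local P (x ∷ X) S = cong₂ _++_
  (≡.trans (cong (row (P ++ x ∷ X ++ S)) (+-identityʳ (length P))) (local P x (X ++ S)))
  (≡.trans (cong₂ (λ ν is → concatMap (row ν) is) (sym (++-assoc P [ x ] (X ++ S))) (applyUpTo-cong next (length X)))
           (rows-local row boxes local (P ++ [ x ]) X S))
  where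
  next : ∀ d → length P + suc d ≡ length (P ++ [ x ]) + d
  next d = sym (≡.trans (cong (_+ d) (length-++ P)) (+-assoc (length P) 1 d))

jFactors : List ℕ → List ℕ → List Poly
jFactors A γ = Rows lamBoxes [] A γ ++ Rows gamBoxes A γ []

jPoly-jFactors : ∀ μ γ → jPoly μ γ ≡ prodP (jFactors (increasing μ) γ)
jPoly-jFactors μ γ = cong prodP (cong₂ _++_
  (rows-local lamRow lamBoxes lamRow-local [] A γ)
  (≡.trans (cong₂ (λ ν is → concatMap (gamRow ν) is) (cong (A ++_) (sym (++-identityʳ γ))) (map-applyUpTo id (length A +_) (length γ)))
           (rows-local gamRow gamBoxes gamRow-local A γ [])))
  where
  A : List ℕ
  A = increasing μ

replicate-∷ʳ : ∀ {A : Set} n (x : A) → replicate n x ∷ʳ x ≡ replicate (suc n) x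
replicate-∷ʳ zero    x = ≡.refl
replicate-∷ʳ (suc n) x = cong (x ∷_) (replicate-∷ʳ n x)

inRange<-true : ∀ {j x v} → j ≤ v → v < x → inRange< j x v ≡ true
inRange<-true j≤v v<x = cong₂ _∧_ (≤ᵇ-true j≤v) (dec-true (_ <? _) v<x)

Rows-lamBoxes-suffix : ∀ {S S′} P X → All (λ x → ∀ j → countB (inRange< j x) S ≡ countB (inRange< j x) S′) X →
  Rows lamBoxes P X S ≡ Rows lamBoxes P X S′
Rows-lamBoxes-suffix P []      []         = ≡.refl
Rows-lamBoxes-suffix {S} {S′} P (x ∷ X) (same ∷ sames) = cong₂ _++_
  (map-cong (λ j → cong (λ n → factor (x ∸ j) (countB (inRange j x) P + n + 1)) (after j)) (cols x))
  (Rows-lamBoxes-suffix (P ++ [ x ]) X sames)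
  where
  after : ∀ j → countB (inRange< j x) (X ++ S) ≡ countB (inRange< j x) (X ++ S′)
  after j = ≡.trans (countB-++ _ X S) (≡.trans (cong (countB (inRange< j x) X +_) (same j)) (sym (countB-++ _ X S′)))

-- A row x of the γ-part sees a final row g after it exactly when it would see a row g + 1 before it.
Rows-gamBoxes-shift : ∀ g {P P′} X S → P′ ↭ suc g ∷ P → Rows gamBoxes P X (g ∷ S) ≡ Rows gamBoxes P′ X S
Rows-gamBoxes-shift g         []      S P′↭ = ≡.refl
Rows-gamBoxes-shift g {P} {P′} (x ∷ X) S P′↭ = cong₂ _++_
  (map-cong (λ j → cong (λ n → factor (x ∸ j + 1) (n + 1)) (arm j)) (cols x))
  (Rows-gamBoxes-shift g X S (↭ₚ.++⁺ʳ [ x ] P′↭))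
  where
  open CommSemigroupProperties ℕₚ.+-commutativeSemigroup using (x∙yz≈yx∙z)
  arm : ∀ j → countB (inRange j x) P + countB (inRange< (j ∸ 1) x) (X ++ g ∷ S)
            ≡ countB (inRange j x) P′ + countB (inRange< (j ∸ 1) x) (X ++ S)
  arm j = begin
    countB before P + countB after (X ++ g ∷ S)
      ≡⟨ cong (countB before P +_) (countB-↭ after (↭ₚ.shift g X S)) ⟩
    countB before P + (indicator (after g) + countB after (X ++ S))
      ≡⟨ x∙yz≈yx∙z (countB before P) (indicator (after g)) _ ⟩
    indicator (after g) + countB before P + countB after (X ++ S)
      ≡⟨ cong (λ b → indicator b + countB before P + countB after (X ++ S)) (cong (_∧ (g <ᵇ x)) (pred-≤ᵇ j g)) ⟩
    countB before (suc g ∷ P) + countB after (X ++ S)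
      ≡⟨ cong (_+ countB after (X ++ S)) (countB-↭ before (↭-sym P′↭)) ⟩
    countB before P′ + countB after (X ++ S) ∎
    where
    open ≡.≡-Reasoning
    before after : ℕ → Bool
    before = inRange j x
    after  = inRange< (j ∸ 1) x

+-shuffle : ∀ a s k c → a + s + (0 + (k + c)) ≡ a + (k + s) + c
+-shuffle = solve-∀

-- Comparing the rows of (α, G^m, γ′, g) and (α, G^(m+1), γ′), where G = g + 1

module RowComparison (g : ℕ) (α γ′ : List ℕ) (α≤g : All (_≤ g) α) where

  open CommMonoidSolver (↭ₚ.++-commutativeMonoid {A = Poly}) using (solve; _⊜_; _⊕_) renaming (id to ∅)

  G : ℕ
  G = suc g

  lastBox : ℕ → Poly
  lastBox s = factor 0 (suc s)

  shortRow : ℕ → List Poly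
  shortRow s =
    map (λ j → factor (G ∸ j) (countB (inRange j G) α + s + countB (inRange< j G) γ′ + 1)) (cols g)

  -- rows s, …, s + r − 1 of the block of G's, whose first g boxes see k further rows after the block
  block : ℕ → ℕ → ℕ → List Poly
  block k s zero    = []
  block k s (suc r) = (shortRow (k + s) ++ [ lastBox s ]) ++ block k (suc s) r

  G-row : ∀ k S → (∀ {j} → j ≤ g → countB (inRange< j G) S ≡ k + countB (inRange< j G) γ′) →
    ∀ s r → lamBoxes G (countIn (α ++ replicate s G)) (countIn (replicate r G ++ S))
            ≡ shortRow (k + s) ++ [ lastBox s ]
  G-row k S seen s r = begin
    map box (cols G)                   ≡⟨ cong (map box) (cols-suc g) ⟩
    map box (cols g ++ [ G ])          ≡⟨ map-++ box (cols g) [ G ] ⟩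
    map box (cols g) ++ [ box G ]      ≡⟨ cong₂ _++_ (map-cong-local (All.map column (cols-≤ g))) (cong [_] corner) ⟩
    shortRow (k + s) ++ [ lastBox s ]  ∎
    where
    open ≡.≡-Reasoning
    box : ℕ → Poly
    box j = factor (G ∸ j)
      (countB (inRange j G) (α ++ replicate s G) + countB (inRange< j G) (replicate r G ++ S) + 1)

    column : ∀ {j} → j ≤ g →
      box j ≡ factor (G ∸ j) (countB (inRange j G) α + (k + s) + countB (inRange< j G) γ′ + 1)
    column {j} j≤g = cong (λ n → factor (G ∸ j) (n + 1)) (begin
      countB (inRange j G) (α ++ replicate s G) + countB (inRange< j G) (replicate r G ++ S)
        ≡⟨ cong₂ _+_ (countB-++ _ α (replicate s G)) (countB-++ _ (replicate r G) S) ⟩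
      countB (inRange j G) α + countB (inRange j G) (replicate s G)
        + (countB (inRange< j G) (replicate r G) + countB (inRange< j G) S)
        ≡⟨ cong₂ (λ a b → countB (inRange j G) α + a + b)
             (countB-replicate s (inRange-true (ℕₚ.m≤n⇒m≤1+n j≤g) ≤-refl))
             (cong₂ _+_ (countB-false (Allₚ.replicate⁺ r (inRange<-above {j} ≤-refl))) (seen j≤g)) ⟩
      countB (inRange j G) α + s + (0 + (k + countB (inRange< j G) γ′))
        ≡⟨ +-shuffle (countB (inRange j G) α) s k (countB (inRange< j G) γ′) ⟩
      countB (inRange j G) α + (k + s) + countB (inRange< j G) γ′ ∎)

    corner : box G ≡ lastBox s
    corner = cong₂ factor (ℕₚ.n∸n≡0 G) (begin
      countB (inRange G G) (α ++ replicate s G) + countB (inRange< G G) (replicate r G ++ S) + 1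
        ≡⟨ cong (λ n → n + countB (inRange< G G) (replicate r G ++ S) + 1) (countB-++ _ α (replicate s G)) ⟩
      countB (inRange G G) α + countB (inRange G G) (replicate s G)
        + countB (inRange< G G) (replicate r G ++ S) + 1
        ≡⟨ cong₂ (λ a c → a + countB (inRange G G) (replicate s G) + c + 1)
             (countB-false (All.map (λ v≤g → inRange-below (s≤s v≤g)) α≤g))
             (countB-false (All.universal (inRange<-empty G) (replicate r G ++ S))) ⟩
      countB (inRange G G) (replicate s G) + 0 + 1
        ≡⟨ cong (λ n → n + 0 + 1) (countB-replicate s (inRange-true {G} ≤-refl ≤-refl)) ⟩
      s + 0 + 1
        ≡⟨ cong (_+ 1) (+-identityʳ s) ⟩
      s + 1
        ≡⟨ +-comm s 1 ⟩
      suc s ∎)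

  G-block : ∀ k S → (∀ {j} → j ≤ g → countB (inRange< j G) S ≡ k + countB (inRange< j G) γ′) →
    ∀ s r {P} → P ≡ α ++ replicate s G → Rows lamBoxes P (replicate r G) S ≡ block k s r
  G-block k S seen s zero    _      = ≡.refl
  G-block k S seen s (suc r) ≡.refl = cong₂ _++_ (G-row k S seen s r)
    (G-block k S seen (suc s) r (≡.trans (++-assoc α (replicate s G) [ G ]) (cong (α ++_) (replicate-∷ʳ s G))))

  block-↭ : ∀ s r → lastBox (s + r) ∷ shortRow s ++ block 1 s r ↭ block 0 s (suc r)
  block-↭ s zero    = begin
    lastBox (s + 0) ∷ shortRow s ++ []    ≡⟨ cong (λ n → lastBox n ∷ shortRow s ++ []) (+-identityʳ s) ⟩
    [ lastBox s ] ++ shortRow s ++ []     ↭⟨ solve 2 (λ e t → e ⊕ t ⊕ ∅ ⊜ (t ⊕ e) ⊕ ∅) ↭-refl [ lastBox s ] (shortRow s) ⟩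
    (shortRow s ++ [ lastBox s ]) ++ []   ∎
    where open PermutationReasoning
  block-↭ s (suc r) = begin
    lastBox (s + suc r) ∷ shortRow s ++ (shortRow (suc s) ++ [ lastBox s ]) ++ block 1 (suc s) r
      ≡⟨ cong (λ n → lastBox n ∷ shortRow s ++ (shortRow (suc s) ++ [ lastBox s ]) ++ block 1 (suc s) r) (+-suc s r) ⟩
    [ e ] ++ shortRow s ++ (shortRow (suc s) ++ [ lastBox s ]) ++ block 1 (suc s) r
      ↭⟨ solve 5 (λ e t t′ f b → e ⊕ t ⊕ (t′ ⊕ f) ⊕ b ⊜ (t ⊕ f) ⊕ (e ⊕ t′ ⊕ b)) ↭-refl
           [ e ] (shortRow s) (shortRow (suc s)) [ lastBox s ] (block 1 (suc s) r) ⟩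
    (shortRow s ++ [ lastBox s ]) ++ (e ∷ shortRow (suc s) ++ block 1 (suc s) r)
      ↭⟨ ↭ₚ.++⁺ˡ (shortRow s ++ [ lastBox s ]) (block-↭ (suc s) r) ⟩
    (shortRow s ++ [ lastBox s ]) ++ block 0 (suc s) (suc r) ∎
    where
    open PermutationReasoning
    e : Poly
    e = lastBox (suc s + r)

  α-rows : ∀ m → Rows lamBoxes [] α (replicate m G ++ γ′ ++ [ g ]) ≡ Rows lamBoxes [] α (replicate (suc m) G ++ γ′)
  α-rows m = Rows-lamBoxes-suffix [] α (All.map unseen α≤g)
    where
    unseen : ∀ {x} → x ≤ g → ∀ j →
      countB (inRange< j x) (replicate m G ++ γ′ ++ [ g ]) ≡ countB (inRange< j x) (G ∷ replicate m G ++ γ′)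
    unseen {x} x≤g j = ≡.trans
      (countB-↭ (inRange< j x) (↭-trans (↭ₚ.++⁺ˡ (replicate m G) (↭-sym (↭ₚ.∷↭∷ʳ g γ′))) (↭ₚ.shift g (replicate m G) γ′)))
      (cong (λ b → indicator b + countB (inRange< j x) (replicate m G ++ γ′))
            (≡.trans (inRange<-above {j} x≤g) (sym (inRange<-above {j} (ℕₚ.m≤n⇒m≤1+n x≤g)))))

  last-γ-row : ∀ m → Rows gamBoxes ((α ++ replicate m G) ++ γ′) [ g ] [] ≡ shortRow 0 ++ []
  last-γ-row m = cong (_++ []) (map-cong-local (All.map column (cols-≤ g)))
    where
    column : ∀ {j} → j ≤ g → factor (g ∸ j + 1) (countB (inRange j g) ((α ++ replicate m G) ++ γ′) + 0 + 1)
                              ≡ factor (G ∸ j) (countB (inRange j G) α + 0 + countB (inRange< j G) γ′ + 1)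
    column {j} j≤g = cong₂ factor
      (≡.trans (+-comm (g ∸ j) 1) (sym (ℕₚ.+-∸-assoc 1 j≤g)))
      (cong (_+ 1) (begin
        countB (inRange j g) ((α ++ replicate m G) ++ γ′) + 0
          ≡⟨ +-identityʳ _ ⟩
        countB (inRange j g) ((α ++ replicate m G) ++ γ′)
          ≡⟨ ≡.trans (countB-++ _ (α ++ replicate m G) γ′) (cong (_+ _) (countB-++ _ α (replicate m G))) ⟩
        countB (inRange j g) α + countB (inRange j g) (replicate m G) + countB (inRange j g) γ′
          ≡⟨ cong₂ _+_ (cong₂ _+_ α-same G-none) γ-same ⟩
        countB (inRange j G) α + 0 + countB (inRange< j G) γ′ ∎))
      where
      open ≡.≡-Reasoning
      α-same : countB (inRange j g) α ≡ countB (inRange j G) α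
      α-same = countB-cong (All.map (λ {v} v≤g → cong ((j ≤ᵇ v) ∧_)
        (≡.trans (≤ᵇ-true v≤g) (sym (≤ᵇ-true (ℕₚ.m≤n⇒m≤1+n v≤g))))) α≤g)
      G-none : countB (inRange j g) (replicate m G) ≡ 0
      G-none = countB-false (Allₚ.replicate⁺ m (inRange-above {j} (ℕₚ.n<1+n g)))
      γ-same : countB (inRange j g) γ′ ≡ countB (inRange< j G) γ′
      γ-same = countB-cong (All.universal (λ v → cong ((j ≤ᵇ v) ∧_) (≤ᵇ≡<ᵇ-suc v g)) γ′)

  jFactors-lhs : ∀ m → jFactors (α ++ replicate m G) (γ′ ++ [ g ])
    ≡ (Rows lamBoxes [] α (replicate (suc m) G ++ γ′) ++ block 1 0 m)
      ++ (Rows gamBoxes (α ++ replicate (suc m) G) γ′ [] ++ (shortRow 0 ++ []))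
  jFactors-lhs m = cong₂ _++_
    (≡.trans (Rows-++ lamBoxes [] α (replicate m G) (γ′ ++ [ g ]))
             (cong₂ _++_ (α-rows m) (G-block 1 (γ′ ++ [ g ]) seen-g 0 m (sym (++-identityʳ α)))))
    (≡.trans (Rows-++ gamBoxes (α ++ replicate m G) γ′ [ g ] [])
             (cong₂ _++_ (Rows-gamBoxes-shift g γ′ [] (↭ₚ.shift G α (replicate m G))) (last-γ-row m)))
    where
    seen-g : ∀ {j} → j ≤ g → countB (inRange< j G) (γ′ ++ [ g ]) ≡ 1 + countB (inRange< j G) γ′
    seen-g {j} j≤g = ≡.trans (countB-↭ (inRange< j G) (↭-sym (↭ₚ.∷↭∷ʳ g γ′)))
      (cong (λ b → indicator b + countB (inRange< j G) γ′) (inRange<-true j≤g (ℕₚ.n<1+n g)))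

  jFactors-rhs : ∀ m → jFactors (α ++ replicate (suc m) G) γ′
    ≡ (Rows lamBoxes [] α (replicate (suc m) G ++ γ′) ++ block 0 0 (suc m)) ++ Rows gamBoxes (α ++ replicate (suc m) G) γ′ []
  jFactors-rhs m = cong (_++ Rows gamBoxes (α ++ replicate (suc m) G) γ′ [])
    (≡.trans (Rows-++ lamBoxes [] α (replicate (suc m) G) γ′)
             (cong (Rows lamBoxes [] α (replicate (suc m) G ++ γ′) ++_) (G-block 0 γ′ (λ _ → ≡.refl) 0 (suc m) (sym (++-identityʳ α)))))

  jFactors-↭ : ∀ m → lastBox m ∷ jFactors (α ++ replicate m G) (γ′ ++ [ g ]) ↭ jFactors (α ++ replicate (suc m) G) γ′
  jFactors-↭ m = begin
    lastBox m ∷ jFactors (α ++ replicate m G) (γ′ ++ [ g ])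
      ≡⟨ cong (lastBox m ∷_) (jFactors-lhs m) ⟩
    [ lastBox m ] ++ (A ++ block 1 0 m) ++ (Γ ++ (shortRow 0 ++ []))
      ↭⟨ solve 5 (λ e a b c t → e ⊕ (a ⊕ b) ⊕ (c ⊕ (t ⊕ ∅)) ⊜ a ⊕ ((e ⊕ t ⊕ b) ⊕ c)) ↭-refl
           [ lastBox m ] A (block 1 0 m) Γ (shortRow 0) ⟩
    A ++ ((lastBox m ∷ shortRow 0 ++ block 1 0 m) ++ Γ)
      ↭⟨ ↭ₚ.++⁺ˡ A (↭ₚ.++⁺ʳ Γ (block-↭ 0 m)) ⟩
    A ++ (block 0 0 (suc m) ++ Γ)
      ≡⟨ ++-assoc A (block 0 0 (suc m)) Γ ⟨
    (A ++ block 0 0 (suc m)) ++ Γ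
      ≡⟨ jFactors-rhs m ⟨
    jFactors (α ++ replicate (suc m) G) γ′ ∎
    where
    open PermutationReasoning
    A Γ : List Poly
    A = Rows lamBoxes [] α (replicate (suc m) G ++ γ′)
    Γ = Rows gamBoxes (α ++ replicate (suc m) G) γ′ []

firstPart-tail : ∀ {x μ} → Linked _≥_ (x ∷ μ) → firstPart μ ≤ x
firstPart-tail [-]       = z≤n
firstPart-tail (x≥y ∷ _) = x≥y

partition-split : ∀ c {μ} → Linked _≥_ μ → firstPart μ ≤ suc c →
  ∃₂ λ m β → μ ≡ replicate m (suc c) ++ β × All (_≤ c) β
partition-split c {[]}    _  _     = 0 , [] , ≡.refl , []
partition-split c {x ∷ μ} μ↘ x≤1+c with x ≟ suc c
... | yes ≡.refl =
  let m , β , μ≡ , β≤c = partition-split c (Linked.tail μ↘) (firstPart-tail μ↘)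
  in  suc m , β , cong (suc c ∷_) μ≡ , β≤c
... | no x≢1+c =
  0 , x ∷ μ , ≡.refl , All.map (λ y≤x → ≤-trans y≤x x≤c) (Linked⇒All (λ x≥y y≥z → ≤-trans y≥z x≥y) ≤-refl μ↘)
  where
  x≤c : x ≤ c
  x≤c = ℕₚ.≤-pred (ℕₚ.≤∧≢⇒< x≤1+c x≢1+c)

mult-replicate-++ : ∀ c m xs → mult c (replicate m c ++ xs) ≡ m + mult c xs
mult-replicate-++ c zero    xs = ≡.refl
mult-replicate-++ c (suc m) xs =
  cong₂ (λ b n → indicator b + n) (dec-true (c ≟ c) ≡.refl) (mult-replicate-++ c m xs)

mult-absent : ∀ {c xs} → All (_≤ c) xs → mult (suc c) xs ≡ 0
mult-absent []                        = ≡.refl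
mult-absent {c} {x ∷ _} (x≤c ∷ xs≤c) =
  cong₂ (λ b n → indicator b + n) (dec-false (x ≟ suc c) (ℕₚ.<⇒≢ (s≤s x≤c))) (mult-absent xs≤c)

replicate-AllPairs : ∀ {A : Set} {R : A → A → Set} {x} → R x x → ∀ m → AllPairs R (replicate m x)
replicate-AllPairs Rxx zero    = []
replicate-AllPairs Rxx (suc m) = Allₚ.replicate⁺ m Rxx ∷ replicate-AllPairs Rxx m

sort-replicate-++ : ∀ m c {xs} → All (_≤ c) xs → sort (replicate m c ++ xs) ≡ sort xs ++ replicate m c
sort-replicate-++ m c {xs} xs≤c = Pointwise-≡⇒≡ (↗↭↗⇒≋ ≤-totalOrder (sort-↗ _) sorted (↭⇒↭ₛ perm))
  where
  sorted : Linked _≤_ (sort xs ++ replicate m c)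
  sorted = AllPairs⇒Sorted ≤-totalOrder (AllPairsₚ.++⁺
    (Sorted⇒AllPairs ≤-totalOrder (sort-↗ xs))
    (replicate-AllPairs ≤-refl m)
    (All.map (Allₚ.replicate⁺ m) (↭ₚ.All-resp-↭ (↭-sym (sort-↭ xs)) xs≤c)))
  perm : sort (replicate m c ++ xs) ↭ sort xs ++ replicate m c
  perm = ↭-trans (sort-↭ _) (↭-trans (↭ₚ.++-comm (replicate m c) xs) (↭ₚ.++⁺ʳ _ (↭-sym (sort-↭ xs))))

lemma6p7 : (μ : List ℕ) → IsPartition μ → (γ′ : List ℕ) (g : ℕ) →
    firstPart μ ≤ suc g →
    jPoly μ (γ′ ++ g ∷ []) *P factor 0 (suc (mult (suc g) μ)) ≈P jPoly (suc g ∷ μ) γ′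
lemma6p7 μ (μ↘ , _) γ′ g μ₁≤1+g with partition-split g μ↘ μ₁≤1+g
... | m , β , ≡.refl , β≤g = coeff-↭ (begin
  jPoly (replicate m G ++ β) (γ′ ++ [ g ]) *P factor 0 (suc (mult G (replicate m G ++ β)))
    ≡⟨ cong₂ _*P_ (jPoly-split m (γ′ ++ [ g ])) (cong lastBox mult≡m) ⟩
  prodP (jFactors (α ++ replicate m G) (γ′ ++ [ g ])) *P lastBox m
    ↭⟨ *P-comm (prodP (jFactors (α ++ replicate m G) (γ′ ++ [ g ]))) (lastBox m) ⟩
  prodP (lastBox m ∷ jFactors (α ++ replicate m G) (γ′ ++ [ g ]))
    ↭⟨ prodP-↭ (jFactors-↭ m) ⟩
  prodP (jFactors (α ++ replicate (suc m) G) γ′)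
    ≡⟨ jPoly-split (suc m) γ′ ⟨
  jPoly (replicate (suc m) G ++ β) γ′ ∎)
  where
  open PermutationReasoning
  α : List ℕ
  α = sort β
  open RowComparison g α γ′ (↭ₚ.All-resp-↭ (↭-sym (sort-↭ β)) β≤g)
  jPoly-split : ∀ n γ → jPoly (replicate n G ++ β) γ ≡ prodP (jFactors (α ++ replicate n G) γ)
  jPoly-split n γ = ≡.trans (jPoly-jFactors (replicate n G ++ β) γ)
    (cong (λ A → prodP (jFactors A γ)) (sort-replicate-++ n G (All.map ℕₚ.m≤n⇒m≤1+n β≤g)))
  mult≡m : mult G (replicate m G ++ β) ≡ m
  mult≡m = ≡.trans (mult-replicate-++ G m β) (≡.trans (cong (m +_) (mult-absent β≤g)) (+-identityʳ m))
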